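{- Let $n = 2k \geq 6$ be even. There is no schedule for an asynchronous single round-robin tournament with $n$ teams that simultaneously has guaranteed rest time $k-2$, games-played difference index $1$, and rest difference index $1$.
   Context: An asynchronous single round-robin tournament with $n$ teams is one in which every pair of distinct teams plays exactly once and no two games are simultaneous; a schedule is a linear ordering of the $\binom{n}{2}$ games. The guaranteed rest time of a schedule is the maximum integer $b$ such that any two games involving the same team are separated by at least $b$ games not involving that team. The games-played difference index is the minimum integer $p$ such that at every point in the schedule, the numbers of games played so far by any two teams differ by at most $p$. The rest difference index is the minimum integer $d$ such that for every game, if one of its teams has not played in $i_1$ consecutive games since its last game and the other in $i_2$ consecutive games since its last game, then $|i_1-i_2|\le d$; for a team playing its first game, all teams are deemed to have played in an imaginary game placed immediately before the first game of the schedule. -}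

module Defs where

open import Data.Nat using (ℕ; zero; suc; _+_; _≤_)
open import Data.Fin using (Fin; _≟_)
open import Data.Bool using (Bool; true; false; if_then_else_; _∨_; _∧_; not)
open import Data.List using (List; []; _∷_; _++_; reverse)
open import Data.Product using (_×_; _,_; proj₁; proj₂)
open import Relation.Nullary using (¬_)
open import Relation.Nullary.Decidable using (⌊_⌋)
open import Relation.Binary.PropositionalEquality using (_≡_; _≢_)

-- A game between two teams of Fin n (an unordered pair, stored as an ordered pair).
Game : ℕ → Set
Game n = Fin n × Fin n

module _ {n : ℕ} where

  _==_ : Fin n → Fin n → Bool
  i == j = ⌊ i ≟ j ⌋

  involves : Fin n → Game n → Bool
  involves t (a , b) = (a == t) ∨ (b == t)

  isGame : Fin n → Fin n → Game n → Bool
  isGame i j (a , b) = ((a == i) ∧ (b == j)) ∨ ((a == j) ∧ (b == i))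

  countB : (Game n → Bool) → List (Game n) → ℕ
  countB P [] = 0
  countB P (g ∷ gs) = if P g then suc (countB P gs) else countB P gs

  played : Fin n → List (Game n) → ℕ
  played t = countB (involves t)

  notInvolving : Fin n → List (Game n) → ℕ
  notInvolving t = countB (λ g → not (involves t g))

  leadingIdle : Fin n → List (Game n) → ℕ
  leadingIdle t [] = 0
  leadingIdle t (g ∷ gs) = if involves t g then 0 else suc (leadingIdle t gs)

  -- number of consecutive games at the end of the prefix xs in which team t has
  -- not played since its last game; if t has not played in xs this is the length
  -- of xs (the imaginary game placed before the first game of the schedule).
  idle : Fin n → List (Game n) → ℕ
  idle t xs = leadingIdle t (reverse xs)

  record IsSchedule (s : List (Game n)) : Set where
    field
      distinctTeams : ∀ xs a b ys → s ≡ xs ++ (a , b) ∷ ys → a ≢ b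
      eachPairOnce  : ∀ i j → i ≢ j → countB (isGame i j) s ≡ 1

  RestAtLeast : List (Game n) → ℕ → Set
  RestAtLeast s b = ∀ t xs g ys g′ zs → s ≡ xs ++ g ∷ ys ++ g′ ∷ zs →
    involves t g ≡ true → involves t g′ ≡ true → b ≤ notInvolving t ys

  PlayedDiffAtMost : List (Game n) → ℕ → Set
  PlayedDiffAtMost s p = ∀ xs ys → s ≡ xs ++ ys → ∀ t u → played t xs ≤ played u xs + p

  RestDiffAtMost : List (Game n) → ℕ → Set
  RestDiffAtMost s d = ∀ xs a b ys → s ≡ xs ++ (a , b) ∷ ys →
    (idle a xs ≤ idle b xs + d) × (idle b xs ≤ idle a xs + d)

  GuaranteedRestTime : List (Game n) → ℕ → Set
  GuaranteedRestTime s b = RestAtLeast s b × (∀ b′ → RestAtLeast s b′ → b′ ≤ b)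

  GamesPlayedDiffIndex : List (Game n) → ℕ → Set
  GamesPlayedDiffIndex s p = PlayedDiffAtMost s p × (∀ p′ → PlayedDiffAtMost s p′ → p ≤ p′)

  RestDiffIndex : List (Game n) → ℕ → Set
  RestDiffIndex s d = RestDiffAtMost s d × (∀ d′ → RestDiffAtMost s d′ → d ≤ d′)

-- 1. Double counting: after m games the teams have played 2m games in total, and
--    every team plays 2k - 1 games.  As the played counts stay within one of each
--    other, after r * k games every team has played exactly r games, so positions
--    r * k, ..., r * k + k - 1 form round r, in which every team plays exactly once
--    (module Rounds).  Rounds 0 to 3 are complete because k ≥ 3.
-- 2. A team's games in rounds r and r + 1 are at least k - 1 positions apart
--    (rest), and the two teams of a game in round r + 1 played their round-r games
--    at positions differing by at most one (rest difference): next-gap and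
--    previous-close.
-- 3. Hence the two opening games of round r + 1 are played by teams that opened
--    round r (module Openings), and all teams opening rounds 0 to 3 are among the
--    teams a, b, c, d of the first two games.
-- 4. So team a opens each of the rounds 0 to 3, every time against a different one
--    of b, c, d: four distinct rivals in a three-element set, a contradiction.
module Submission where

open import Defs
open import Data.Nat using (ℕ; _*_; _∸_; _≤_)
open import Data.Nat using () renaming (_≟_ to _≟ℕ_)
open import Data.List using (List)
open import Data.Product using (_×_)
open import Relation.Nullary using (¬_)

open import Data.Nat using (zero; suc; _+_; _<_; _⊓_; _⊔_; z≤n; s≤s; s≤s⁻¹; _<?_)
open import Data.Nat.Properties hiding (_≟_)
open import Data.Nat.Tactic.RingSolver using (solve-∀)
open import Data.Bool using (Bool; true; false; _∨_; _∧_; if_then_else_)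
open import Data.Bool.Properties using (∧-zeroʳ; ∧-identityʳ; ∨-identityʳ; ∨-zeroʳ)
open import Data.Fin using (Fin; _≟_; punchIn)
open import Data.Fin.Properties using (punchInᵢ≢i)
open import Data.List using ([]; _∷_; _++_; take; drop; length)
open import Data.List.Properties using (++-assoc; length-take; length-drop; drop-drop; take-take; take-all; take++drop≡id; reverse-++)
open import Data.List.Relation.Unary.All using (All; []; _∷_)
open import Data.List.Relation.Unary.All.Properties using (++⁻ˡ)
open import Data.Product using (_,_; proj₁; proj₂; Σ-syntax)
open import Data.Sum using (_⊎_; inj₁; inj₂)
open import Data.Empty using (⊥; ⊥-elim)
open import Function using (_∘_)
open import Relation.Nullary using (Dec; yes; no)
open import Relation.Nullary.Decidable using (isYes≗does; dec-true; dec-false)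
open import Relation.Binary.PropositionalEquality
open import Relation.Binary.Definitions using (tri<; tri≈; tri>)
open import Algebra.Properties.CommutativeMonoid.Sum +-0-commutativeMonoid
  using (sum; sum-syntax; ∑-distrib-+; sum-cong-≗; sum-remove)

ind : Bool → ℕ
ind true  = 1
ind false = 0

module _ {n : ℕ} where

  ==-refl : (i : Fin n) → (i == i) ≡ true
  ==-refl i = trans (isYes≗does (i ≟ i)) (dec-true (i ≟ i) refl)

  ==-false : {i j : Fin n} → i ≢ j → (i == j) ≡ false
  ==-false {i} {j} i≢j = trans (isYes≗does (i ≟ j)) (dec-false (i ≟ j) i≢j)

  ==-sound : {i j : Fin n} → (i == j) ≡ true → i ≡ j
  ==-sound {i} {j} eq with i ≟ j
  ... | yes i≡j = i≡j
  ==-sound () | no _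

  Proper : Game n → Set
  Proper g = proj₁ g ≢ proj₂ g

  involves-sound : ∀ t (g : Game n) → involves t g ≡ true → proj₁ g ≡ t ⊎ proj₂ g ≡ t
  involves-sound t (a , b) eq with a == t in a≡t
  ... | true  = inj₁ (==-sound a≡t)
  ... | false = inj₂ (==-sound eq)

  involves-fst : (g : Game n) → involves (proj₁ g) g ≡ true
  involves-fst (a , b) rewrite ==-refl a = refl

  involves-snd : (g : Game n) → involves (proj₂ g) g ≡ true
  involves-snd (a , b) rewrite ==-refl b with a == b
  ... | true  = refl
  ... | false = refl

  isGame-complete : ∀ x y (g : Game n) → x ≢ y →
    involves x g ≡ true → involves y g ≡ true → isGame x y g ≡ true
  isGame-complete x y g@(a , b) x≢y x∈g y∈g
    with involves-sound x g x∈g | involves-sound y g y∈g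
  ... | inj₁ refl | inj₁ refl = ⊥-elim (x≢y refl)
  ... | inj₁ refl | inj₂ refl rewrite ==-refl a | ==-refl b = refl
  ... | inj₂ refl | inj₁ refl rewrite ==-refl a | ==-refl b = ∨-zeroʳ _
  ... | inj₂ refl | inj₂ refl = ⊥-elim (x≢y refl)

  isGame-fst : ∀ {a b : Fin n} → a ≢ b → ∀ u → isGame a u (a , b) ≡ (b == u)
  isGame-fst {a} {b} a≢b u rewrite ==-refl a | ==-false (λ b≡a → a≢b (sym b≡a)) =
    trans (cong ((b == u) ∨_) (∧-zeroʳ (a == u))) (∨-identityʳ (b == u))

  isGame-snd : ∀ {a b : Fin n} → a ≢ b → ∀ u → isGame b u (a , b) ≡ (a == u)
  isGame-snd {a} {b} a≢b u rewrite ==-refl b | ==-false a≢b = ∧-identityʳ (a == u)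

  isGame-other : ∀ {a b t : Fin n} → a ≢ t → b ≢ t → ∀ u → isGame t u (a , b) ≡ false
  isGame-other {a} {b} {t} a≢t b≢t u rewrite ==-false a≢t | ==-false b≢t = ∧-zeroʳ (a == u)

  isGame-self : ∀ (g : Game n) → Proper g → ∀ t → isGame t t g ≡ false
  isGame-self (a , b) a≢b t with a ≟ t
  ... | yes refl rewrite ==-false (λ b≡a → a≢b (sym b≡a)) = refl
  ... | no _ = refl

module _ {n : ℕ} (P : Game n → Bool) where

  countB-∷ : ∀ g gs → countB P (g ∷ gs) ≡ ind (P g) + countB P gs
  countB-∷ g gs with P g
  ... | true  = refl
  ... | false = refl

  countB-++ : ∀ xs ys → countB P (xs ++ ys) ≡ countB P xs + countB P ys
  countB-++ []       ys = refl
  countB-++ (g ∷ xs) ys = begin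
    countB P (g ∷ xs ++ ys)                    ≡⟨ countB-∷ g (xs ++ ys) ⟩
    ind (P g) + countB P (xs ++ ys)            ≡⟨ cong (ind (P g) +_) (countB-++ xs ys) ⟩
    ind (P g) + (countB P xs + countB P ys)    ≡⟨ +-assoc (ind (P g)) _ _ ⟨
    (ind (P g) + countB P xs) + countB P ys    ≡⟨ cong (_+ countB P ys) (countB-∷ g xs) ⟨
    countB P (g ∷ xs) + countB P ys            ∎
    where open ≡-Reasoning

  countB-≤-length : ∀ xs → countB P xs ≤ length xs
  countB-≤-length []       = z≤n
  countB-≤-length (g ∷ xs) with P g
  ... | true  = s≤s (countB-≤-length xs)
  ... | false = m≤n⇒m≤1+n (countB-≤-length xs)

  countB-prefix : ∀ xs {p q} → p ≤ q → countB P (take p xs) ≤ countB P (take q xs)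
  countB-prefix xs {p} {q} p≤q = begin
    countB P (take p xs)                             ≡⟨ cong (λ i → countB P (take i xs)) (m≤n⇒m⊓n≡m p≤q) ⟨
    countB P (take (p ⊓ q) xs)                       ≡⟨ cong (countB P) (take-take p q xs) ⟨
    countB P (take p ys)                             ≤⟨ m≤m+n _ _ ⟩
    countB P (take p ys) + countB P (drop p ys)      ≡⟨ countB-++ (take p ys) (drop p ys) ⟨
    countB P (take p ys ++ drop p ys)                ≡⟨ cong (countB P) (take++drop≡id p ys) ⟩
    countB P ys                                      ∎
    where
    open ≤-Reasoning
    ys : List (Game n)
    ys = take q xs

sum-const : ∀ n c → ∑[ i < n ] c ≡ n * c
sum-const zero    c = refl
sum-const (suc n) c = cong (c +_) (sum-const n c)

sum-mono : ∀ {n} {f g : Fin n → ℕ} → (∀ i → f i ≤ g i) → sum f ≤ sum g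
sum-mono {zero}  f≤g = z≤n
sum-mono {suc n} f≤g = +-mono-≤ (f≤g Fin.zero) (sum-mono (λ i → f≤g (Fin.suc i)))

sum-strict : ∀ {n} {f g : Fin n → ℕ} → (∀ i → f i ≤ g i) → ∀ j → f j < g j → sum f < sum g
sum-strict {suc n} f≤g Fin.zero    lt = +-mono-<-≤ lt (sum-mono (λ i → f≤g (Fin.suc i)))
sum-strict {suc n} f≤g (Fin.suc j) lt = +-mono-≤-< (f≤g Fin.zero) (sum-strict (λ i → f≤g (Fin.suc i)) j lt)

sum-indicator : ∀ {n} (a : Fin n) → ∑[ t < n ] ind (a == t) ≡ 1
sum-indicator {suc n} a = begin
  ∑[ t < suc n ] ind (a == t)                    ≡⟨ sum-remove {i = a} (λ t → ind (a == t)) ⟩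
  ind (a == a) + ∑[ j < n ] ind (a == punchIn a j) ≡⟨ cong₂ _+_ (cong ind (==-refl a)) (sum-cong-≗ off) ⟩
  1 + ∑[ j < n ] 0                               ≡⟨ cong suc (sum-const n 0) ⟩
  1 + n * 0                                      ≡⟨ cong suc (*-zeroʳ n) ⟩
  1                                              ∎
  where
  open ≡-Reasoning
  off : ∀ j → ind (a == punchIn a j) ≡ 0
  off j = cong ind (==-false (λ a≡ → punchInᵢ≢i a j (sym a≡)))

balanced-constant : ∀ {n} (f : Fin n → ℕ) r → (∀ t u → f t ≤ f u + 1) →
  sum f ≡ n * r → ∀ t → f t ≡ r
balanced-constant {n} f r close total t with <-cmp (f t) r
... | tri≈ _ ft≡r _ = ft≡r
... | tri< ft<r _ _ = ⊥-elim (<-irrefl (trans total (sym (sum-const n r)))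
      (sum-strict (λ u → ≤-trans (close u t) (subst (_≤ r) (+-comm 1 (f t)) ft<r)) t ft<r))
... | tri> _ _ r<ft = ⊥-elim (<-irrefl (sym (trans total (sym (sum-const n r))))
      (sum-strict (λ u → +-cancelʳ-≤ 1 r (f u) (≤-trans (subst (_≤ f t) (+-comm 1 r) r<ft) (close t u))) t r<ft))

module _ {n : ℕ} where

  sum-involves : (g : Game n) → Proper g → ∑[ t < n ] ind (involves t g) ≡ 2
  sum-involves (a , b) a≢b = begin
    ∑[ t < n ] ind (involves t (a , b))              ≡⟨ sum-cong-≗ split ⟩
    ∑[ t < n ] (ind (a == t) + ind (b == t))         ≡⟨ ∑-distrib-+ (λ t → ind (a == t)) (λ t → ind (b == t)) ⟩
    ∑[ t < n ] ind (a == t) + ∑[ t < n ] ind (b == t) ≡⟨ cong₂ _+_ (sum-indicator a) (sum-indicator b) ⟩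
    2                                                ∎
    where
    open ≡-Reasoning
    split : ∀ t → ind ((a == t) ∨ (b == t)) ≡ ind (a == t) + ind (b == t)
    split t with a == t in a≡t | b == t in b≡t
    ... | true  | true  = ⊥-elim (a≢b (trans (==-sound a≡t) (sym (==-sound b≡t))))
    ... | true  | false = refl
    ... | false | _     = refl

  sum-played : ∀ xs → All Proper xs → ∑[ t < n ] played t xs ≡ 2 * length xs
  sum-played []       [] = trans (sum-const n 0) (*-zeroʳ n)
  sum-played (g ∷ xs) (pg ∷ pxs) = begin
    ∑[ t < n ] played t (g ∷ xs)                                 ≡⟨ sum-cong-≗ (λ t → countB-∷ (involves t) g xs) ⟩
    ∑[ t < n ] (ind (involves t g) + played t xs)                ≡⟨ ∑-distrib-+ (λ t → ind (involves t g)) (λ t → played t xs) ⟩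
    ∑[ t < n ] ind (involves t g) + ∑[ t < n ] played t xs        ≡⟨ cong₂ _+_ (sum-involves g pg) (sum-played xs pxs) ⟩
    2 + 2 * length xs                                            ≡⟨ *-suc 2 (length xs) ⟨
    2 * length (g ∷ xs)                                          ∎
    where open ≡-Reasoning

  sum-isGame : ∀ t (g : Game n) → Proper g → ∑[ u < n ] ind (isGame t u g) ≡ ind (involves t g)
  sum-isGame t (a , b) a≢b = decide (a ≟ t) (b ≟ t)
    where
    Claim : Fin n → Set
    Claim x = ∑[ u < n ] ind (isGame x u (a , b)) ≡ ind (involves x (a , b))
    decide : Dec (a ≡ t) → Dec (b ≡ t) → Claim t
    decide (yes a≡t) _ = subst Claim a≡t
      (trans (sum-cong-≗ (λ u → cong ind (isGame-fst a≢b u)))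
             (trans (sum-indicator b) (sym (cong ind (involves-fst (a , b))))))
    decide (no _) (yes b≡t) = subst Claim b≡t
      (trans (sum-cong-≗ (λ u → cong ind (isGame-snd a≢b u)))
             (trans (sum-indicator a) (sym (cong ind (involves-snd (a , b))))))
    decide (no a≢t) (no b≢t) =
      trans (sum-cong-≗ (λ u → cong ind (isGame-other a≢t b≢t u)))
      (trans (sum-const n 0) (trans (*-zeroʳ n) (cong ind (sym (cong₂ _∨_ (==-false a≢t) (==-false b≢t))))))

  sum-pairs : ∀ t xs → All Proper xs → ∑[ u < n ] countB (isGame t u) xs ≡ played t xs
  sum-pairs t []       [] = trans (sum-const n 0) (*-zeroʳ n)
  sum-pairs t (g ∷ xs) (pg ∷ pxs) = begin
    ∑[ u < n ] countB (isGame t u) (g ∷ xs)                                ≡⟨ sum-cong-≗ (λ u → countB-∷ (isGame t u) g xs) ⟩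
    ∑[ u < n ] (ind (isGame t u g) + countB (isGame t u) xs)               ≡⟨ ∑-distrib-+ (λ u → ind (isGame t u g)) (λ u → countB (isGame t u) xs) ⟩
    ∑[ u < n ] ind (isGame t u g) + ∑[ u < n ] countB (isGame t u) xs       ≡⟨ cong₂ _+_ (sum-isGame t g pg) (sum-pairs t xs pxs) ⟩
    ind (involves t g) + played t xs                                       ≡⟨ countB-∷ (involves t) g xs ⟨
    played t (g ∷ xs)                                                      ∎
    where open ≡-Reasoning

  no-self-games : ∀ (t : Fin n) (xs : List (Game n)) → All Proper xs → countB (isGame t t) xs ≡ 0
  no-self-games t []       []         = refl
  no-self-games t (g ∷ xs) (pg ∷ pxs) rewrite isGame-self g pg t = no-self-games t xs pxs

module _ {A : Set} (dummy : A) where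

  -- The element at position j of a list (dummy beyond its end).
  at : List A → ℕ → A
  at []       j       = dummy
  at (x ∷ xs) zero    = x
  at (x ∷ xs) (suc j) = at xs j

  split-at : ∀ xs j → j < length xs → xs ≡ take j xs ++ at xs j ∷ drop (suc j) xs
  split-at (x ∷ xs) zero    _         = refl
  split-at (x ∷ xs) (suc j) (s≤s j<) = cong (x ∷_) (split-at xs j j<)

  take-suc-at : ∀ xs j → j < length xs → take (suc j) xs ≡ take j xs ++ at xs j ∷ []
  take-suc-at (x ∷ xs) zero    _         = refl
  take-suc-at (x ∷ xs) (suc j) (s≤s j<) = cong (x ∷_) (take-suc-at xs j j<)

  at-drop : ∀ xs i j → at (drop i xs) j ≡ at xs (i + j)
  at-drop xs       zero    j = refl
  at-drop []       (suc i) j = refl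
  at-drop (x ∷ xs) (suc i) j = at-drop xs i j

  split-two : ∀ xs p q → p < q → q < length xs → Σ[ between ∈ List A ]
    (xs ≡ take p xs ++ at xs p ∷ between ++ at xs q ∷ drop (suc q) xs) × (suc p + length between ≡ q)
  split-two xs p q p<q q<len =
    take j rest , trans (split-at xs p (<-trans p<q q<len)) (cong (λ r → take p xs ++ at xs p ∷ r) rest≡) , len≡
    where
    rest : List A
    rest = drop (suc p) xs
    j : ℕ
    j = q ∸ suc p
    p+j≡q : suc p + j ≡ q
    p+j≡q = m+[n∸m]≡n p<q
    j<rest : j < length rest
    j<rest = subst (j <_) (sym (length-drop (suc p) xs)) (∸-monoˡ-< q<len p<q)
    rest≡ : rest ≡ take j rest ++ at xs q ∷ drop (suc q) xs
    rest≡ = begin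
      rest                                               ≡⟨ split-at rest j j<rest ⟩
      take j rest ++ at rest j ∷ drop (suc j) rest       ≡⟨ cong₂ (λ g r → take j rest ++ g ∷ r)
                                                              (trans (at-drop xs (suc p) j) (cong (at xs) p+j≡q))
                                                              (trans (drop-drop (suc p) (suc j) xs) (cong (λ i → drop i xs) (trans (+-suc (suc p) j) (cong suc p+j≡q)))) ⟩
      take j rest ++ at xs q ∷ drop (suc q) xs           ∎
      where open ≡-Reasoning
    len≡ : suc p + length (take j rest) ≡ q
    len≡ = trans (cong (suc p +_) (trans (length-take j rest) (m≤n⇒m⊓n≡m (<⇒≤ j<rest)))) p+j≡q

module Schedule {m : ℕ} (s : List (Game (suc m))) (sch : IsSchedule s) where

  L : ℕ
  L = length s

  dummyGame : Game (suc m)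
  dummyGame = (Fin.zero , Fin.zero)

  G : ℕ → Game (suc m)
  G = at dummyGame s

  At : Fin (suc m) → ℕ → Set
  At t p = involves t (G p) ≡ true

  countBefore : (Game (suc m) → Bool) → ℕ → ℕ
  countBefore P p = countB P (take p s)

  count-step : ∀ P p → p < L → countBefore P (suc p) ≡ countBefore P p + ind (P (G p))
  count-step P p p<L = begin
    countB P (take (suc p) s)               ≡⟨ cong (countB P) (take-suc-at dummyGame s p p<L) ⟩
    countB P (take p s ++ G p ∷ [])         ≡⟨ countB-++ P (take p s) (G p ∷ []) ⟩
    countBefore P p + countB P (G p ∷ [])   ≡⟨ cong (countBefore P p +_) (trans (countB-∷ P (G p) []) (+-identityʳ _)) ⟩
    countBefore P p + ind (P (G p))         ∎
    where open ≡-Reasoning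

  count-witness : ∀ P p q → p ≤ q → q ≤ L → countBefore P p < countBefore P q →
    Σ[ j ∈ ℕ ] (p ≤ j × j < q × P (G j) ≡ true)
  count-witness P p zero    p≤0 _ lt = ⊥-elim (<-irrefl (cong (countBefore P) (n≤0⇒n≡0 p≤0)) lt)
  count-witness P p (suc q) p≤q′ q<L lt with p ≟ℕ suc q | P (G q) in hit
  ... | yes refl | _    = ⊥-elim (<-irrefl refl lt)
  ... | no p≢q′ | true  = q , <⇒≤pred (≤∧≢⇒< p≤q′ p≢q′) , ≤-refl , hit
  ... | no p≢q′ | false with count-witness P p q (<⇒≤pred (≤∧≢⇒< p≤q′ p≢q′)) (<⇒≤ q<L)
                             (subst (countBefore P p <_) unchanged lt)
    where
    unchanged : countBefore P (suc q) ≡ countBefore P q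
    unchanged = trans (count-step P q q<L) (trans (cong (λ b → countBefore P q + ind b) hit) (+-identityʳ _))
  ...   | j , p≤j , j<q , Pj = j , p≤j , m≤n⇒m≤1+n j<q , Pj

  count-two : ∀ P p q → p < q → q < L → P (G p) ≡ true → P (G q) ≡ true →
    2 + countBefore P p ≤ countBefore P (suc q)
  count-two P p q p<q q<L Pp Pq = begin
    2 + countBefore P p                 ≡⟨ cong suc (trans (cong (countBefore P p +_) (cong ind Pp)) (+-comm _ 1)) ⟨
    suc (countBefore P p + ind (P (G p))) ≡⟨ cong suc (count-step P p (<-trans p<q q<L)) ⟨
    suc (countBefore P (suc p))         ≤⟨ s≤s (countB-prefix P s p<q) ⟩
    suc (countBefore P q)               ≡⟨ trans (+-comm 1 _) (cong (λ b → countBefore P q + ind b) (sym Pq)) ⟩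
    countBefore P q + ind (P (G q))     ≡⟨ count-step P q q<L ⟨
    countBefore P (suc q)               ∎
    where open ≤-Reasoning

  count-total : ∀ P p → countBefore P p ≤ countB P s
  count-total P p = ≤-trans (countB-prefix P s (m≤m⊔n p L)) (≤-reflexive (cong (countB P) (take-all (p ⊔ L) s (m≤n⊔m p L))))

  idleBefore : Fin (suc m) → ℕ → ℕ
  idleBefore t p = idle t (take p s)

  idle-step : ∀ t p → p < L →
    idleBefore t (suc p) ≡ (if involves t (G p) then 0 else suc (idleBefore t p))
  idle-step t p p<L rewrite take-suc-at dummyGame s p p<L | reverse-++ (take p s) (G p ∷ []) = refl

  idle-since : ∀ t p q → p < q → q ≤ L → At t p → (∀ j → p < j → j < q → ¬ At t j) →
    idleBefore t q + suc p ≡ q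
  idle-since t p (suc q) (s≤s p≤q) q<L tp absent with m≤n⇒m<n∨m≡n p≤q
  ... | inj₂ refl rewrite idle-step t p q<L | tp = refl
  ... | inj₁ p<q with involves t (G q) in tq
  ...   | true  = ⊥-elim (absent q p<q ≤-refl tq)
  ...   | false rewrite idle-step t q q<L | tq =
    cong suc (idle-since t p q p<q (<⇒≤ q<L) tp (λ j p<j j<q → absent j p<j (m≤n⇒m≤1+n j<q)))

  rest-gap : ∀ {b} → RestAtLeast s b → ∀ t p q → p < q → q < L → At t p → At t q → suc p + b ≤ q
  rest-gap {b} rest t p q p<q q<L tp tq with split-two dummyGame s p q p<q q<L
  ... | between , s≡ , len≡ = subst (suc p + b ≤_) len≡ (+-monoʳ-≤ (suc p)
        (≤-trans (rest t (take p s) (G p) between (G q) (drop (suc q) s) s≡ tp tq) (countB-≤-length _ between)))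

  proper-suffix : ∀ pre ys → s ≡ pre ++ ys → All Proper ys
  proper-suffix pre []            _    = []
  proper-suffix pre ((a , b) ∷ ys) s≡ = IsSchedule.distinctTeams sch pre a b ys s≡
    ∷ proper-suffix (pre ++ (a , b) ∷ []) ys (trans s≡ (sym (++-assoc pre ((a , b) ∷ []) ys)))

  proper : All Proper s
  proper = proper-suffix [] s refl

  proper-at : ∀ p → p < L → Proper (G p)
  proper-at p p<L = IsSchedule.distinctTeams sch (take p s) (proj₁ (G p)) (proj₂ (G p)) (drop (suc p) s)
    (split-at dummyGame s p p<L)

  meet-twice : ∀ x y p q → x ≢ y → p < q → q < L → At x p → At y p → At x q → At y q → ⊥
  meet-twice x y p q x≢y p<q q<L xp yp xq yq = 1+n≰n (begin
    2                                  ≤⟨ m≤m+n 2 _ ⟩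
    2 + countBefore (isGame x y) p      ≤⟨ count-two (isGame x y) p q p<q q<L
                                            (isGame-complete x y (G p) x≢y xp yp) (isGame-complete x y (G q) x≢y xq yq) ⟩
    countBefore (isGame x y) (suc q)    ≤⟨ count-total (isGame x y) (suc q) ⟩
    countB (isGame x y) s               ≡⟨ IsSchedule.eachPairOnce sch x y x≢y ⟩
    1                                  ∎)
    where open ≤-Reasoning

  games-per-team : ∀ t → suc (played t s) ≡ suc m
  games-per-team t = begin
    suc (played t s)                                                 ≡⟨ +-comm 1 _ ⟩
    played t s + 1                                                   ≡⟨ cong₂ _+_ (sum-pairs t s proper) (sum-indicator t) ⟨
    ∑[ u < suc m ] countB (isGame t u) s + ∑[ u < suc m ] ind (t == u) ≡⟨ ∑-distrib-+ (λ u → countB (isGame t u) s) (λ u → ind (t == u)) ⟨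
    ∑[ u < suc m ] (countB (isGame t u) s + ind (t == u))             ≡⟨ sum-cong-≗ once ⟩
    ∑[ u < suc m ] 1                                                 ≡⟨ trans (sum-const (suc m) 1) (*-identityʳ (suc m)) ⟩
    suc m                                                            ∎
    where
    open ≡-Reasoning
    once : ∀ u → countB (isGame t u) s + ind (t == u) ≡ 1
    once u with t ≟ u
    ... | yes refl = cong (_+ 1) (no-self-games t s proper)
    ... | no t≢u   = trans (+-identityʳ _) (IsSchedule.eachPairOnce sch t u t≢u)

module Rounds (k₁ : ℕ) (s : List (Game (2 * suc k₁))) (sch : IsSchedule s)
              (balanced : PlayedDiffAtMost s 1) where

  open Schedule s sch public

  k : ℕ
  k = suc k₁

  InRound : ℕ → ℕ → Set
  InRound r p = r * k ≤ p × p < suc r * k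

  proper-prefix : ∀ p → All Proper (take p s)
  proper-prefix p = ++⁻ˡ (take p s) (subst (All Proper) (sym (take++drop≡id p s)) proper)

  -- After r complete rounds every team has played exactly r games: the counts
  -- differ by at most one and add up to 2 * (r * k) = n * r.
  played-after : ∀ r → r * k ≤ L → ∀ t → countBefore (involves t) (r * k) ≡ r
  played-after r rk≤L = balanced-constant (λ t → countBefore (involves t) (r * k)) r
    (balanced (take (r * k) s) (drop (r * k) s) (sym (take++drop≡id (r * k) s)))
    (begin
      ∑[ t < 2 * k ] played t (take (r * k) s)   ≡⟨ sum-played (take (r * k) s) (proper-prefix (r * k)) ⟩
      2 * length (take (r * k) s)               ≡⟨ cong (2 *_) (trans (length-take (r * k) s) (m≤n⇒m⊓n≡m rk≤L)) ⟩
      2 * (r * k)                               ≡⟨ cong (2 *_) (*-comm r k) ⟩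
      2 * (k * r)                               ≡⟨ *-assoc 2 k r ⟨
      2 * k * r                                 ∎)
    where open ≡-Reasoning

  round-exists : ∀ r → suc r * k ≤ L → ∀ t → Σ[ p ∈ ℕ ] (InRound r p × At t p)
  round-exists r end≤L t with count-witness (involves t) (r * k) (suc r * k) (m≤n+m (r * k) k) end≤L
                                (subst₂ _<_ (sym (played-after r (≤-trans (m≤n+m (r * k) k) end≤L) t))
                                            (sym (played-after (suc r) end≤L t)) (n<1+n r))
  ... | p , start≤p , p<end , tp = p , (start≤p , p<end) , tp

  round-twice : ∀ r → suc r * k ≤ L → ∀ t p q → InRound r p → InRound r q → p < q → At t p → At t q → ⊥
  round-twice r end≤L t p q (start≤p , _) (_ , q<end) p<q tp tq = 1+n≰n (begin
    2 + r                                ≡⟨ cong (2 +_) (played-after r (≤-trans (m≤n+m (r * k) k) end≤L) t) ⟨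
    2 + countBefore (involves t) (r * k)  ≤⟨ +-monoʳ-≤ 2 (countB-prefix (involves t) s start≤p) ⟩
    2 + countBefore (involves t) p        ≤⟨ count-two (involves t) p q p<q (<-≤-trans q<end end≤L) tp tq ⟩
    countBefore (involves t) (suc q)      ≤⟨ countB-prefix (involves t) s q<end ⟩
    countBefore (involves t) (suc r * k)  ≡⟨ played-after (suc r) end≤L t ⟩
    suc r                                ∎)
    where open ≤-Reasoning

  round-unique : ∀ r → suc r * k ≤ L → ∀ t p q → InRound r p → InRound r q → At t p → At t q → p ≡ q
  round-unique r end≤L t p q p∈r q∈r tp tq with <-cmp p q
  ... | tri< p<q _ _ = ⊥-elim (round-twice r end≤L t p q p∈r q∈r p<q tp tq)
  ... | tri≈ _ p≡q _ = p≡q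
  ... | tri> _ _ q<p = ⊥-elim (round-twice r end≤L t q p q∈r p∈r q<p tq tp)

  -- Every team plays n - 1 = 2k - 1 games, so the schedule has k * (2k - 1)
  -- games and consists of 2k - 1 complete rounds.
  schedule-length : L ≡ k * (2 * k ∸ 1)
  schedule-length = *-cancelˡ-≡ L (k * (2 * k ∸ 1)) 2 (begin
    2 * L                                   ≡⟨ sum-played s proper ⟨
    ∑[ t < 2 * k ] played t s                ≡⟨ sum-cong-≗ (λ t → suc-injective (games-per-team t)) ⟩
    ∑[ t < 2 * k ] (2 * k ∸ 1)               ≡⟨ sum-const (2 * k) (2 * k ∸ 1) ⟩
    2 * k * (2 * k ∸ 1)                      ≡⟨ *-assoc 2 k (2 * k ∸ 1) ⟩
    2 * (k * (2 * k ∸ 1))                    ∎)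
    where open ≡-Reasoning

  round-complete : ∀ r → r < 2 * k ∸ 1 → suc r * k ≤ L
  round-complete r r<rounds = begin
    suc r * k           ≤⟨ *-monoˡ-≤ k r<rounds ⟩
    (2 * k ∸ 1) * k     ≡⟨ *-comm (2 * k ∸ 1) k ⟩
    k * (2 * k ∸ 1)     ≡⟨ schedule-length ⟨
    L                   ∎
    where open ≤-Reasoning

  round-before : ∀ {r r′ p q} → r < r′ → InRound r p → InRound r′ q → p < q
  round-before r<r′ (_ , p<end) (start≤q , _) = <-≤-trans p<end (≤-trans (*-monoˡ-≤ k r<r′) start≤q)

module _ {A : Set} where

  no-three-in-two : ∀ {c d x y z : A} → x ≡ c ⊎ x ≡ d → y ≡ c ⊎ y ≡ d → z ≡ c ⊎ z ≡ d →
    x ≢ y → x ≢ z → y ≢ z → ⊥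
  no-three-in-two (inj₁ refl) (inj₁ refl) _           x≢y _   _   = x≢y refl
  no-three-in-two (inj₂ refl) (inj₂ refl) _           x≢y _   _   = x≢y refl
  no-three-in-two (inj₁ refl) (inj₂ refl) (inj₁ refl) _   x≢z _   = x≢z refl
  no-three-in-two (inj₁ refl) (inj₂ refl) (inj₂ refl) _   _   y≢z = y≢z refl
  no-three-in-two (inj₂ refl) (inj₁ refl) (inj₁ refl) _   _   y≢z = y≢z refl
  no-three-in-two (inj₂ refl) (inj₁ refl) (inj₂ refl) _   x≢z _   = x≢z refl

  _∈3_ : A → A × A × A → Set
  x ∈3 (b , c , d) = x ≡ b ⊎ x ≡ c ⊎ x ≡ d

  no-four-in-three : ∀ {b c d w x y z : A} → w ∈3 (b , c , d) → x ∈3 (b , c , d) →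
    y ∈3 (b , c , d) → z ∈3 (b , c , d) →
    w ≢ x → w ≢ y → w ≢ z → x ≢ y → x ≢ z → y ≢ z → ⊥
  no-four-in-three (inj₁ refl) x∈ y∈ z∈ w≢x w≢y w≢z =
    no-three-in-two (not-first x∈ w≢x) (not-first y∈ w≢y) (not-first z∈ w≢z)
    where
    not-first : ∀ {b c d x : A} → x ∈3 (b , c , d) → b ≢ x → x ≡ c ⊎ x ≡ d
    not-first (inj₁ refl) b≢x = ⊥-elim (b≢x refl)
    not-first (inj₂ x∈)   _   = x∈
  no-four-in-three (inj₂ (inj₁ refl)) x∈ y∈ z∈ w≢x w≢y w≢z =
    no-three-in-two (not-second x∈ w≢x) (not-second y∈ w≢y) (not-second z∈ w≢z)
    where
    not-second : ∀ {b c d x : A} → x ∈3 (b , c , d) → c ≢ x → x ≡ b ⊎ x ≡ d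
    not-second (inj₁ x≡b)         _   = inj₁ x≡b
    not-second (inj₂ (inj₁ refl)) c≢x = ⊥-elim (c≢x refl)
    not-second (inj₂ (inj₂ x≡d))  _   = inj₂ x≡d
  no-four-in-three (inj₂ (inj₂ refl)) x∈ y∈ z∈ w≢x w≢y w≢z =
    no-three-in-two (not-third x∈ w≢x) (not-third y∈ w≢y) (not-third z∈ w≢z)
    where
    not-third : ∀ {b c d x : A} → x ∈3 (b , c , d) → d ≢ x → x ≡ b ⊎ x ≡ c
    not-third (inj₁ x≡b)         _   = inj₁ x≡b
    not-third (inj₂ (inj₁ x≡c))  _   = inj₂ x≡c
    not-third (inj₂ (inj₂ refl)) d≢x = ⊥-elim (d≢x refl)

-- From now on k = 3 + k₀ ≥ 3 and the schedule s of the 2k teams has guaranteed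
-- rest k - 2, games-played difference at most 1 and rest difference at most 1.
module Main (k₀ : ℕ) (s : List (Game (2 * (3 + k₀)))) (sch : IsSchedule s)
            (rest : RestAtLeast s (suc k₀)) (balanced : PlayedDiffAtMost s 1)
            (rest-diff : RestDiffAtMost s 1) where

  open Rounds (2 + k₀) s sch balanced

  -- Rounds 0, 1, 2 and 3 are complete, as there are 2k - 1 ≥ 5 rounds.
  complete : ∀ r → r ≤ 3 → suc r * k ≤ L
  complete r r≤3 = round-complete r (≤-trans (s≤s r≤3) (s≤s (s≤s (≤-trans (s≤s (s≤s z≤n)) (m≤n+m _ k₀)))))

  in-schedule : ∀ {r p} → r ≤ 3 → InRound r p → p < L
  in-schedule {r} r≤3 (_ , p<end) = <-≤-trans p<end (complete r r≤3)

  early-in-round : ∀ r i → i < 3 → InRound r (i + r * k)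
  early-in-round r i i<3 = m≤n+m (r * k) i , +-monoˡ-< (r * k) (≤-trans i<3 (s≤s (s≤s (s≤s z≤n))))

  round-disjoint : ∀ {r p q x y} → r ≤ 3 → InRound r p → InRound r q → p ≢ q → At x p → At y q → x ≢ y
  round-disjoint {r} r≤3 p∈r q∈r p≢q xp yq refl = p≢q (round-unique r (complete r r≤3) _ _ _ p∈r q∈r xp yq)

  opponent : Fin (2 * k) → ℕ → Fin (2 * k)
  opponent t p = if proj₁ (G p) == t then proj₂ (G p) else proj₁ (G p)

  opponent-plays : ∀ t p → At (opponent t p) p
  opponent-plays t p with proj₁ (G p) ≟ t
  ... | yes _ = involves-snd (G p)
  ... | no _  = involves-fst (G p)

  opponent-≢ : ∀ t p → p < L → At t p → opponent t p ≢ t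
  opponent-≢ t p p<L tp with proj₁ (G p) ≟ t | involves-sound t (G p) tp
  ... | yes fst≡t | _          = λ snd≡t → proper-at p p<L (trans fst≡t (sym snd≡t))
  ... | no fst≢t  | inj₁ fst≡t = ⊥-elim (fst≢t fst≡t)
  ... | no _      | inj₂ snd≡t = λ fst≡t → proper-at p p<L (trans fst≡t (sym snd≡t))

  no-third-team : ∀ {x y z p} → At x p → At y p → At z p → x ≢ y → x ≢ z → y ≢ z → ⊥
  no-third-team {p = p} xp yp zp =
    no-three-in-two (entry xp) (entry yp) (entry zp)
    where
    entry : ∀ {t} → At t p → t ≡ proj₁ (G p) ⊎ t ≡ proj₂ (G p)
    entry {t} tp with involves-sound t (G p) tp
    ... | inj₁ fst≡t = inj₁ (sym fst≡t)
    ... | inj₂ snd≡t = inj₂ (sym snd≡t)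

  meet-in-two-rounds : ∀ {r r′ x y p q} → r < r′ → r′ ≤ 3 → x ≢ y → InRound r p → InRound r′ q →
    At x p → At y p → At x q → At y q → ⊥
  meet-in-two-rounds {x = x} {y} {p} {q} r<r′ r′≤3 x≢y p∈ q∈ =
    meet-twice x y p q x≢y (round-before r<r′ p∈ q∈) (in-schedule r′≤3 q∈)

  next-gap : ∀ {r t p q} → r ≤ 2 → InRound r p → InRound (suc r) q → At t p → At t q →
    suc p + suc k₀ ≤ q
  next-gap {r} {t} {p} {q} r≤2 p∈ q∈ =
    rest-gap rest t p q (round-before (n<1+n r) p∈ q∈) (in-schedule (s≤s r≤2) q∈)

  next-idle : ∀ {r t p q} → r ≤ 2 → InRound r p → InRound (suc r) q → At t p → At t q →
    idleBefore t q + suc p ≡ q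
  next-idle {r} {t} {p} {q} r≤2 p∈ q∈ tp tq =
    idle-since t p q (round-before (n<1+n r) p∈ q∈) (<⇒≤ (in-schedule (s≤s r≤2) q∈)) tp absent
    where
    absent : ∀ j → p < j → j < q → ¬ At t j
    absent j p<j j<q tj with j <? suc r * k
    ... | yes j<end = <-irrefl (round-unique r (complete r (m≤n⇒m≤1+n r≤2)) t p j p∈
                        (≤-trans (proj₁ p∈) (<⇒≤ p<j) , j<end) tp tj) p<j
    ... | no j≮end  = <-irrefl (round-unique (suc r) (complete (suc r) (s≤s r≤2)) t j q
                        (≮⇒≥ j≮end , <-trans j<q (proj₂ q∈)) q∈ tj tq) j<q

  idle-balanced : ∀ {x y q} → q < L → x ≢ y → At x q → At y q → idleBefore x q ≤ idleBefore y q + 1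
  idle-balanced {x} {y} {q} q<L x≢y xq yq
    with rest-diff (take q s) (proj₁ (G q)) (proj₂ (G q)) (drop (suc q) s) (split-at dummyGame s q q<L)
       | involves-sound x (G q) xq | involves-sound y (G q) yq
  ... | _    , _    | inj₁ refl | inj₁ refl = ⊥-elim (x≢y refl)
  ... | fst≤ , _    | inj₁ refl | inj₂ refl = fst≤
  ... | _    , snd≤ | inj₂ refl | inj₁ refl = snd≤
  ... | _    , _    | inj₂ refl | inj₂ refl = ⊥-elim (x≢y refl)

  previous-close : ∀ {r x y px py q} → r ≤ 2 → x ≢ y → InRound r px → InRound r py →
    InRound (suc r) q → At x px → At y py → At x q → At y q → py ≤ suc px
  previous-close {r} {x} {y} {px} {py} {q} r≤2 x≢y px∈ py∈ q∈ xpx ypy xq yq = s≤s⁻¹ (+-cancelˡ-≤ (idleBefore y q) _ _ (begin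
    idleBefore y q + suc py        ≡⟨ trans (next-idle r≤2 py∈ q∈ ypy yq) (sym (next-idle r≤2 px∈ q∈ xpx xq)) ⟩
    idleBefore x q + suc px        ≤⟨ +-monoˡ-≤ (suc px) (idle-balanced (in-schedule (s≤s r≤2) q∈) x≢y xq yq) ⟩
    idleBefore y q + 1 + suc px    ≡⟨ +-assoc (idleBefore y q) 1 (suc px) ⟩
    idleBefore y q + suc (suc px)  ∎))
    where open ≤-Reasoning

  Opening : ℕ → Fin (2 * k) → Set
  Opening r t = At t (r * k) ⊎ At t (suc (r * k))

  -- The opening games of round r + 1 are played only by teams that opened round r.
  module Openings (r : ℕ) (r≤2 : r ≤ 2) where

    B Q : ℕ
    B = r * k
    Q = suc r * k

    r≤3 : r ≤ 3
    r≤3 = m≤n⇒m≤1+n r≤2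

    B∈ : InRound r B
    B∈ = early-in-round r 0 (s≤s z≤n)
    B₁∈ : InRound r (suc B)
    B₁∈ = early-in-round r 1 (s≤s (s≤s z≤n))
    B₂∈ : InRound r (suc (suc B))
    B₂∈ = early-in-round r 2 ≤-refl
    Q∈ : InRound (suc r) Q
    Q∈ = early-in-round (suc r) 0 (s≤s z≤n)
    Q₁∈ : InRound (suc r) (suc Q)
    Q₁∈ = early-in-round (suc r) 1 (s≤s (s≤s z≤n))

    apart : ∀ {p q x y} → InRound r p → InRound r q → p < q → At x p → At y q → x ≢ y
    apart p∈ q∈ p<q = round-disjoint r≤3 p∈ q∈ (<⇒≢ p<q)
    apart′ : ∀ {p q x y} → InRound (suc r) p → InRound (suc r) q → p ≢ q → At x p → At y q → x ≢ y
    apart′ p∈ q∈ p≢q = round-disjoint (s≤s r≤2) p∈ q∈ p≢q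

    previous-bound : ∀ {t p} c → InRound r p → InRound (suc r) (c + Q) → At t p → At t (c + Q) →
      p ≤ c + suc B
    previous-bound {p = p} c p∈ cQ∈ tp tcQ = +-cancelʳ-≤ (2 + k₀) p (c + suc B)
      (subst₂ _≤_ (lhs p k₀) (rhs c B k₀) (next-gap r≤2 p∈ cQ∈ tp tcQ))
      where
      lhs : ∀ p k₀ → suc p + suc k₀ ≡ p + (2 + k₀)
      lhs = solve-∀
      rhs : ∀ c B k₀ → c + (3 + k₀ + B) ≡ c + suc B + (2 + k₀)
      rhs = solve-∀

    two-options : ∀ {t p} → B ≤ p → p ≤ suc B → At t p → Opening r t
    two-options B≤p p≤B₁ tp with m≤n⇒m<n∨m≡n p≤B₁
    ... | inj₁ p<B₁ = inj₁ (subst (λ i → At _ i) (≤-antisym (s≤s⁻¹ p<B₁) B≤p) tp)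
    ... | inj₂ p≡B₁ = inj₂ (subst (λ i → At _ i) p≡B₁ tp)

    first-slot : ∀ t → At t Q → Opening r t
    first-slot t tQ = from-round (round-exists r (complete r r≤3) t)
      where
      from-round : Σ[ p ∈ ℕ ] (InRound r p × At t p) → Opening r t
      from-round (p , p∈ , tp) = two-options (proj₁ p∈) (previous-bound 0 p∈ Q∈ tp tQ) tp

    -- The first opening game {x, y} of round r + 1 cannot be fed from positions
    -- B and B + 1 while the second one {w, z} is fed from B + 1 and B + 2.  For
    -- let u be x's opponent at B and v the opponent of u in round r + 1.  As u is
    -- none of x, y, w, z, its game q is not an opening game; v played at B or B + 1
    -- (previous-close with u), which puts three distinct teams into one game.
    crossed : ∀ {x y z w} → At x B → At y (suc B) → At w (suc B) → At z (suc (suc B)) →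
      At x Q → At y Q → At w (suc Q) → At z (suc Q) → ⊥
    crossed {x} {y} {z} {w} xB yB₁ wB₁ zB₂ xQ yQ wQ₁ zQ₁ = meet-u (round-exists (suc r) (complete (suc r) (s≤s r≤2)) u)
      where
      u : Fin (2 * k)
      u = opponent x B
      uB : At u B
      uB = opponent-plays x B
      x≢u : x ≢ u
      x≢u x≡u = opponent-≢ x B (in-schedule r≤3 B∈) xB (sym x≡u)
      meet-u : Σ[ q ∈ ℕ ] (InRound (suc r) q × At u q) → ⊥
      meet-u (q , q∈ , uq) = meet-v (round-exists r (complete r r≤3) v)
        where
        v : Fin (2 * k)
        v = opponent u q
        vq : At v q
        vq = opponent-plays u q
        q≢Q : q ≢ Q
        q≢Q refl = no-third-team xQ yQ uq (apart B∈ B₁∈ (n<1+n B) xB yB₁) x≢u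
                     (λ y≡u → apart B∈ B₁∈ (n<1+n B) uB yB₁ (sym y≡u))
        q≢Q₁ : q ≢ suc Q
        q≢Q₁ refl = no-third-team wQ₁ zQ₁ uq (apart B₁∈ B₂∈ (n<1+n _) wB₁ zB₂)
                      (λ w≡u → apart B∈ B₁∈ (n<1+n B) uB wB₁ (sym w≡u))
                      (λ z≡u → apart B∈ B₂∈ (m<n+m B (s≤s z≤n)) uB zB₂ (sym z≡u))
        v-opened : Opening r v → ⊥
        v-opened (inj₁ vB)  = no-third-team xB uB vB x≢u (apart′ Q∈ q∈ (q≢Q ∘ sym) xQ vq)
                           (λ u≡v → opponent-≢ u q (in-schedule (s≤s r≤2) q∈) uq (sym u≡v))
        v-opened (inj₂ vB₁) = no-third-team yB₁ wB₁ vB₁ (apart′ Q∈ Q₁∈ (<⇒≢ (n<1+n Q)) yQ wQ₁)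
                           (apart′ Q∈ q∈ (q≢Q ∘ sym) yQ vq) (apart′ Q₁∈ q∈ (q≢Q₁ ∘ sym) wQ₁ vq)
        meet-v : Σ[ pv ∈ ℕ ] (InRound r pv × At v pv) → ⊥
        meet-v (pv , pv∈ , vpv) = v-opened (two-options (proj₁ pv∈)
          (previous-close r≤2 (λ u≡v → opponent-≢ u q (in-schedule (s≤s r≤2) q∈) uq (sym u≡v)) B∈ pv∈ q∈ uB vpv uq vq) vpv)

    -- No team of the second opening game of round r + 1 played at B + 2.  For its
    -- opponent w then played at B + 1 (previous-close; B + 2 would repeat the
    -- pair), and the teams of the first opening game, coming from B or B + 1
    -- (first-slot), either repeat a pair or are fed crosswise.
    not-from-third : ∀ z → At z (suc Q) → At z (suc (suc B)) → ⊥
    not-from-third z zQ₁ zB₂ = from-w (round-exists r (complete r r≤3) w)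
      where
      w : Fin (2 * k)
      w = opponent z (suc Q)
      wQ₁ : At w (suc Q)
      wQ₁ = opponent-plays z (suc Q)
      w≢z : w ≢ z
      w≢z = opponent-≢ z (suc Q) (in-schedule (s≤s r≤2) Q₁∈) zQ₁
      x y : Fin (2 * k)
      x = proj₁ (G Q)
      y = proj₂ (G Q)
      xQ : At x Q
      xQ = involves-fst (G Q)
      yQ : At y Q
      yQ = involves-snd (G Q)
      x≢y : x ≢ y
      x≢y = proper-at Q (in-schedule (s≤s r≤2) Q∈)
      fed : At w (suc B) → Opening r x → Opening r y → ⊥
      fed wB₁ (inj₁ xB)  (inj₁ yB)  = meet-in-two-rounds (n<1+n r) (s≤s r≤2) x≢y B∈ Q∈ xB yB xQ yQ
      fed wB₁ (inj₂ xB₁) (inj₂ yB₁) = meet-in-two-rounds (n<1+n r) (s≤s r≤2) x≢y B₁∈ Q∈ xB₁ yB₁ xQ yQ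
      fed wB₁ (inj₁ xB)  (inj₂ yB₁) = crossed xB yB₁ wB₁ zB₂ xQ yQ wQ₁ zQ₁
      fed wB₁ (inj₂ xB₁) (inj₁ yB)  = crossed yB xB₁ wB₁ zB₂ yQ xQ wQ₁ zQ₁
      from-w : Σ[ pw ∈ ℕ ] (InRound r pw × At w pw) → ⊥
      from-w (pw , pw∈ , wpw) = position (m≤n⇒m<n∨m≡n (previous-bound 1 pw∈ Q₁∈ wpw wQ₁))
        where
        B₁≤pw : suc B ≤ pw
        B₁≤pw = s≤s⁻¹ (previous-close r≤2 w≢z pw∈ B₂∈ Q₁∈ wpw zB₂ wQ₁ zQ₁)
        position : pw < suc (suc B) ⊎ pw ≡ suc (suc B) → ⊥
        position (inj₁ pw<B₂) = fed (subst (At w) (≤-antisym (s≤s⁻¹ pw<B₂) B₁≤pw) wpw) (first-slot x xQ) (first-slot y yQ)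
        position (inj₂ pw≡B₂) = meet-in-two-rounds (n<1+n r) (s≤s r≤2) (w≢z ∘ sym) B₂∈ Q₁∈ zB₂
                                  (subst (At w) pw≡B₂ wpw) zQ₁ wQ₁

    second-slot : ∀ z → At z (suc Q) → Opening r z
    second-slot z zQ₁ = from-round (round-exists r (complete r r≤3) z)
      where
      from-round : Σ[ p ∈ ℕ ] (InRound r p × At z p) → Opening r z
      from-round (p , p∈ , zp) = position (m≤n⇒m<n∨m≡n (previous-bound 1 p∈ Q₁∈ zp zQ₁))
        where
        position : p < suc (suc B) ⊎ p ≡ suc (suc B) → Opening r z
        position (inj₁ p<B₂) = two-options (proj₁ p∈) (s≤s⁻¹ p<B₂) zp
        position (inj₂ p≡B₂) = ⊥-elim (not-from-third z zQ₁ (subst (At z) p≡B₂ zp))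

    opening-step : ∀ t → Opening (suc r) t → Opening r t
    opening-step t (inj₁ tQ)  = first-slot t tQ
    opening-step t (inj₂ tQ₁) = second-slot t tQ₁

  opening-origin : ∀ r → r ≤ 3 → ∀ t → Opening r t → Opening 0 t
  opening-origin zero    _         t opens = opens
  opening-origin (suc r) (s≤s r≤2) t opens =
    opening-origin r (m≤n⇒m≤1+n r≤2) t (Openings.opening-step r r≤2 t opens)

  a b c d : Fin (2 * k)
  a = proj₁ (G 0)
  b = proj₂ (G 0)
  c = proj₁ (G 1)
  d = proj₂ (G 1)

  among-bcd : ∀ {r t} → r ≤ 3 → Opening r t → t ≢ a → t ∈3 (b , c , d)
  among-bcd {r} {t} r≤3 opens t≢a = from-origin (opening-origin r r≤3 t opens)
    where
    from-origin : Opening 0 t → t ∈3 (b , c , d)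
    from-origin (inj₁ t0) with involves-sound t (G 0) t0
    ... | inj₁ a≡t = ⊥-elim (t≢a (sym a≡t))
    ... | inj₂ b≡t = inj₁ (sym b≡t)
    from-origin (inj₂ t1) with involves-sound t (G 1) t1
    ... | inj₁ c≡t = inj₂ (inj₁ (sym c≡t))
    ... | inj₂ d≡t = inj₂ (inj₂ (sym d≡t))

  -- Team a opens each of the rounds 0 to 3: otherwise the four distinct teams of
  -- the two opening games would all be among b, c, d.
  a-opens : ∀ r → r ≤ 3 → Opening r a
  a-opens r r≤3 = decide (involves a (G B)) (involves a (G (suc B))) refl refl
    where
    B : ℕ
    B = r * k
    B∈ : InRound r B
    B∈ = early-in-round r 0 (s≤s z≤n)
    B₁∈ : InRound r (suc B)
    B₁∈ = early-in-round r 1 (s≤s (s≤s z≤n))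
    not-a : ∀ {t p} → involves a (G p) ≡ false → At t p → t ≢ a
    not-a a∉ tp refl with () ← trans (sym a∉) tp
    decide : ∀ i₀ i₁ → involves a (G B) ≡ i₀ → involves a (G (suc B)) ≡ i₁ → Opening r a
    decide true  _     a∈ _  = inj₁ a∈
    decide false true  _  a∈ = inj₂ a∈
    decide false false a∉ a∉′ = ⊥-elim (no-four-in-three
      (among-bcd r≤3 (inj₁ xB) (not-a a∉ xB)) (among-bcd r≤3 (inj₁ yB) (not-a a∉ yB))
      (among-bcd r≤3 (inj₂ zB₁) (not-a a∉′ zB₁)) (among-bcd r≤3 (inj₂ wB₁) (not-a a∉′ wB₁))
      (proper-at B (in-schedule r≤3 B∈)) (apart xB zB₁) (apart xB wB₁)
      (apart yB zB₁) (apart yB wB₁) (proper-at (suc B) (in-schedule r≤3 B₁∈)))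
      where
      xB : At (proj₁ (G B)) B
      xB = involves-fst (G B)
      yB : At (proj₂ (G B)) B
      yB = involves-snd (G B)
      zB₁ : At (proj₁ (G (suc B))) (suc B)
      zB₁ = involves-fst (G (suc B))
      wB₁ : At (proj₂ (G (suc B))) (suc B)
      wB₁ = involves-snd (G (suc B))
      apart : ∀ {x y} → At x B → At y (suc B) → x ≢ y
      apart = round-disjoint r≤3 B∈ B₁∈ (<⇒≢ (n<1+n B))

  record Meeting (r : ℕ) : Set where
    field
      pos         : ℕ
      rival       : Fin (2 * k)
      in-round    : InRound r pos
      a-plays     : At a pos
      rival-plays : At rival pos
      a≢rival     : a ≢ rival
      rival∈      : rival ∈3 (b , c , d)
  open Meeting

  meeting : ∀ r → r ≤ 3 → Meeting r
  meeting r r≤3 = from-opening (a-opens r r≤3)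
    where
    meet-at : ∀ p → InRound r p → At a p → Opening r (opponent a p) → Meeting r
    meet-at p p∈ ap opens = record
      { pos = p ; rival = opponent a p ; in-round = p∈ ; a-plays = ap ; rival-plays = opponent-plays a p
      ; a≢rival = a≢o ; rival∈ = among-bcd r≤3 opens (a≢o ∘ sym) }
      where
      a≢o : a ≢ opponent a p
      a≢o a≡o = opponent-≢ a p (in-schedule r≤3 p∈) ap (sym a≡o)
    from-opening : Opening r a → Meeting r
    from-opening (inj₁ aB)  = meet-at (r * k) (early-in-round r 0 (s≤s z≤n)) aB (inj₁ (opponent-plays a (r * k)))
    from-opening (inj₂ aB₁) = meet-at (suc (r * k)) (early-in-round r 1 (s≤s (s≤s z≤n))) aB₁
                                (inj₂ (opponent-plays a (suc (r * k))))

  -- Rivals met in different rounds are different, since a pair meets only once.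
  rivals-differ : ∀ {r r′} → r < r′ → r′ ≤ 3 → (m : Meeting r) (m′ : Meeting r′) → rival m ≢ rival m′
  rivals-differ r<r′ r′≤3 m m′ same = meet-in-two-rounds r<r′ r′≤3 (a≢rival m) (in-round m) (in-round m′)
    (a-plays m) (rival-plays m) (a-plays m′) (subst (λ t → At t (pos m′)) (sym same) (rival-plays m′))

  impossible : ⊥
  impossible = no-four-in-three (rival∈ m₀) (rival∈ m₁) (rival∈ m₂) (rival∈ m₃)
    (rivals-differ 0<1 1≤3 m₀ m₁) (rivals-differ 0<2 2≤3 m₀ m₂) (rivals-differ 0<3 ≤-refl m₀ m₃)
    (rivals-differ 1<2 2≤3 m₁ m₂) (rivals-differ 1<3 ≤-refl m₁ m₃) (rivals-differ 2<3 ≤-refl m₂ m₃)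
    where
    0<1 : 0 < 1
    0<1 = s≤s z≤n
    0<2 : 0 < 2
    0<2 = s≤s z≤n
    0<3 : 0 < 3
    0<3 = s≤s z≤n
    1<2 : 1 < 2
    1<2 = s≤s (s≤s z≤n)
    1<3 : 1 < 3
    1<3 = s≤s (s≤s z≤n)
    2<3 : 2 < 3
    2<3 = s≤s (s≤s (s≤s z≤n))
    1≤3 : 1 ≤ 3
    1≤3 = s≤s z≤n
    2≤3 : 2 ≤ 3
    2≤3 = s≤s (s≤s z≤n)
    m₀ : Meeting 0
    m₀ = meeting 0 z≤n
    m₁ : Meeting 1
    m₁ = meeting 1 1≤3
    m₂ : Meeting 2
    m₂ = meeting 2 2≤3
    m₃ : Meeting 3
    m₃ = meeting 3 ≤-refl

theorem3p3 : ∀ (k : ℕ) → 3 ≤ k → (s : List (Game (2 * k))) → IsSchedule s →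
    ¬ (GuaranteedRestTime s (k ∸ 2) × GamesPlayedDiffIndex s 1 × RestDiffIndex s 1)
theorem3p3 (suc (suc (suc k₀))) (s≤s (s≤s (s≤s _))) s sch ((rest , _) , (balanced , _) , (rest-diff , _)) =
  Main.impossible k₀ s sch rest balanced rest-diff
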